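{- If $G$ is a Klee-graph of order at least $10$ containing three (distinct) triangles, then $G$ is the tricorn or a descendant of the tricorn.
   Context: For a cubic graph $G$ and $v\in V(G)$, $G^v$ is obtained by replacing $v$ with a triangle: delete $v$ (with neighbours $x_1,x_2,x_3$), add new vertices $v_1,v_2,v_3$, edges $v_ix_i$ and $v_1v_2,v_2v_3,v_3v_1$. Klee-graphs are defined recursively: $K_4$ is a Klee-graph, and if $H$ is a Klee-graph and $w\in V(H)$ then $H^w$ is a Klee-graph. A descendant of a graph $H$ is any graph obtained from $H$ by a (nonempty) sequence of such vertex-to-triangle replacements. The tricorn is the cubic graph on 10 vertices obtained from $K_4$ by replacing three of its four vertices with triangles; explicitly, vertices $1,\dots,10$ and edges $12,13,14,25,26,37,38,49,4\,10,56,5\,10,67,78,89,9\,10$. -}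

module Defs where

open import Data.Nat using (ℕ; zero; suc; _+_; _≤_)
open import Data.Fin using (Fin; zero; suc; toℕ; _<_)
open import Data.Product using (Σ; _×_; _,_; ∃-syntax)
open import Data.Sum using (_⊎_)
open import Data.Unit using (⊤)
open import Data.Empty using (⊥)
open import Data.List using (List; []; _∷_)
open import Data.List.Membership.Propositional using (_∈_)
open import Relation.Binary.PropositionalEquality using (_≡_; _≢_)
open import Function.Bundles using (_↔_; _⇔_; Inverse)

record Graph : Set₁ where
  constructor mkGraph
  field
    n : ℕ
    E : Fin n → Fin n → Set
open Graph public

_≅_ : Graph → Graph → Set
G ≅ H = Σ (Fin (n G) ↔ Fin (n H)) λ f →
  ∀ u w → E G u w ⇔ E H (Inverse.to f u) (Inverse.to f w)

-- G^v: v (with neighbours x₁ x₂ x₃) is replaced by the triangle v₁ v₂ v₃,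
-- where v₁ reuses the old index of v (shifted), v₂ = index 0, v₃ = index 1.
-- Edges: v₁x₁, v₂x₂, v₃x₃, v₁v₂, v₂v₃, v₃v₁, and all edges of G not at v.
expand : (G : Graph) → (v x₁ x₂ x₃ : Fin (n G)) → Graph
expand G v x₁ x₂ x₃ = mkGraph (suc (suc (n G))) adj
  where
  adj : Fin (suc (suc (n G))) → Fin (suc (suc (n G))) → Set
  adj zero zero = ⊥
  adj zero (suc zero) = ⊤
  adj (suc zero) zero = ⊤
  adj (suc zero) (suc zero) = ⊥
  adj zero (suc (suc w)) = (w ≡ v) ⊎ (w ≡ x₂)
  adj (suc (suc w)) zero = (w ≡ v) ⊎ (w ≡ x₂)
  adj (suc zero) (suc (suc w)) = (w ≡ v) ⊎ (w ≡ x₃)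
  adj (suc (suc w)) (suc zero) = (w ≡ v) ⊎ (w ≡ x₃)
  adj (suc (suc u)) (suc (suc w)) =
    E G u w × (u ≡ v → w ≡ x₁) × (w ≡ v → u ≡ x₁)

IsExpansion : Graph → Graph → Set
IsExpansion G H = ∃[ v ] ∃[ x₁ ] ∃[ x₂ ] ∃[ x₃ ]
  ( (x₁ ≢ x₂) × (x₁ ≢ x₃) × (x₂ ≢ x₃)
  × E G v x₁ × E G v x₂ × E G v x₃
  × (∀ y → E G v y → (y ≡ x₁) ⊎ (y ≡ x₂) ⊎ (y ≡ x₃))
  × (H ≅ expand G v x₁ x₂ x₃) )

K₄ : Graph
K₄ = mkGraph 4 (λ u w → u ≢ w)

data Klee : Graph → Set₁ where
  base : ∀ {G} → G ≅ K₄ → Klee G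
  step : ∀ {H G} → Klee H → IsExpansion H G → Klee G

data Descendant (H : Graph) : Graph → Set₁ where
  one  : ∀ {G} → IsExpansion H G → Descendant H G
  more : ∀ {G' G} → Descendant H G' → IsExpansion G' G → Descendant H G

-- The tricorn; vertex i (1..10) of the paper is Fin index i-1.
tricornEdges : List (ℕ × ℕ)
tricornEdges =
  (1 , 2) ∷ (1 , 3) ∷ (1 , 4) ∷ (2 , 5) ∷ (2 , 6) ∷ (3 , 7) ∷ (3 , 8) ∷
  (4 , 9) ∷ (4 , 10) ∷ (5 , 6) ∷ (5 , 10) ∷ (6 , 7) ∷ (7 , 8) ∷ (8 , 9) ∷
  (9 , 10) ∷ []

tricorn : Graph
tricorn = mkGraph 10 (λ u w →
  ((suc (toℕ u) , suc (toℕ w)) ∈ tricornEdges) ⊎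
  ((suc (toℕ w) , suc (toℕ u)) ∈ tricornEdges))

-- A triangle, recorded by its vertex set {a,b,c} with a < b < c.
Triangle : Graph → Set
Triangle G = Σ (Fin (n G) × Fin (n G) × Fin (n G)) λ { (a , b , c) →
  (a < b) × (b < c) × E G a b × E G b c × E G a c }

triVerts : ∀ {G} → Triangle G → Fin (n G) × Fin (n G) × Fin (n G)
triVerts (t , _) = t

HasThreeTriangles : Graph → Set
HasThreeTriangles G = ∃[ t₁ ] ∃[ t₂ ] ∃[ t₃ ]
  ( (triVerts {G} t₁ ≢ triVerts {G} t₂)
  × (triVerts {G} t₁ ≢ triVerts {G} t₃)
  × (triVerts {G} t₂ ≢ triVerts {G} t₃) )

{-# OPTIONS --safe #-}
-- Every Klee graph is K₄, the tricorn or a descendant of it, or path-like: its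
-- only triangles are two disjoint end triangles, each created by an expansion,
-- and expanding any vertex off them gives the tricorn or a descendant. This
-- trichotomy survives each expansion. Expanding a vertex of an end triangle
-- gives a path-like graph whose new end is the triangle just created; the other
-- two vertices of the old end are then off the ends, and expanding one of them
-- amounts to expanding a vertex t and then two corners of its triangle. As
-- expansions at distinct vertices commute, any vertex of a Klee graph can be
-- left untouched until the last expansion, which reduces this to t being a
-- vertex of K₄, where the result is the tricorn itself. A path-like graph has
-- only two triangles and K₄ has four vertices, which gives the theorem.
module Submission where

open import Defs
open import Data.Nat as ℕ using (zero; suc; _≤_)
import Data.Nat.Properties as ℕP
open import Data.Fin as Fin using (Fin; zero; suc; toℕ)
open import Data.Fin.Patterns using (0F; 1F; 2F; 3F; 4F; 5F; 6F; 7F; 8F; 9F)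
open import Data.Fin.Properties using (_≟_; all?; any?)
import Data.Fin.Properties as FinP
open import Data.Fin.Permutation using (Permutation′; transpose; _⟨$⟩ʳ_; _⟨$⟩ˡ_; inverseˡ; inverseʳ; ↔⇒≡)
open import Data.Product using (Σ; _×_; _,_; proj₁; proj₂; ∃-syntax; uncurry)
import Data.Product.Properties as Product
open import Data.Sum using (_⊎_; inj₁; inj₂)
open import Data.Unit using (tt)
open import Data.Empty using (⊥; ⊥-elim)
import Data.Maybe as Maybe
import Data.List as List
open import Data.List.Membership.DecPropositional (Product.≡-dec ℕ._≟_ ℕ._≟_) using (_∈?_)
open import Data.Vec using ([]; _∷_; lookup)
open import Relation.Nullary using (¬_; Dec; yes; no)
open import Relation.Nullary.Decidable using (dec-true; from-no; toWitness; map′; ¬?; _×-dec_; _⊎-dec_; _→-dec_)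
open import Relation.Binary.PropositionalEquality
open import Function.Bundles using (_⇔_; Inverse; mk⇔; mk↔ₛ′; Equivalence)
open import Function.Properties.Equivalence as ⇔ using () renaming (trans to infixr 5 _⟨⇔⟩_)

open Equivalence using (to; from)


-- Expanding a vertex into a triangle

Triple : Graph → Set
Triple G = Fin 3 → Fin (n G)

expandAt : (G : Graph) → Fin (n G) → Triple G → Graph
expandAt G v xs = expand G v (xs 0F) (xs 1F) (xs 2F)

record Neighbours (G : Graph) (v : Fin (n G)) (xs : Triple G) : Set where
  field
    nbr-injective : ∀ i j → xs i ≡ xs j → i ≡ j
    nbr-adjacent  : ∀ i → E G v (xs i)
    nbr-complete  : ∀ y → E G v y → ∃[ i ] y ≡ xs i
open Neighbours public

record Simple (G : Graph) : Set where
  field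
    E-sym    : ∀ {u w} → E G u w → E G w u
    E-irrefl : ∀ u → ¬ E G u u
open Simple public

E-sym⇔ : ∀ {G} → Simple G → ∀ a b → E G a b ⇔ E G b a
E-sym⇔ S a b = mk⇔ (E-sym S) (E-sym S)

E-resp-≡ : ∀ (G : Graph) {a a′ b b′} → a ≡ a′ → b ≡ b′ → E G a b ⇔ E G a′ b′
E-resp-≡ G refl refl = ⇔.refl

edge⇒≢ : ∀ {G} → Simple G → ∀ {a b} → E G a b → a ≢ b
edge⇒≢ S {a} e refl = E-irrefl S a e

nbr≢centre : ∀ {G v xs} → Neighbours G v xs → Simple G → ∀ i → xs i ≢ v
nbr≢centre {G} N S i xs≡v = E-irrefl S _ (subst (E G _) xs≡v (nbr-adjacent N i))

-- The vertices of expandAt G v xs are keep u for u ≢ v and the corners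
-- corner v i, joined to xs i; corner v 0F reuses the index of v.
pattern keep u = suc (suc u)

corner : ∀ {m} → Fin m → Fin 3 → Fin (suc (suc m))
corner v 0F = keep v
corner v 1F = zero
corner v 2F = suc zero

data Position {m} (v : Fin m) : Fin (suc (suc m)) → Set where
  old : ∀ u → u ≢ v → Position v (keep u)
  new : ∀ i → Position v (corner v i)

position : ∀ {m} (v : Fin m) a → Position v a
position v zero = new 1F
position v (suc zero) = new 2F
position v (keep u) with u ≟ v
... | yes refl = new 0F
... | no u≢v = old u u≢v

corner-injective : ∀ {m} (v : Fin m) i j → corner v i ≡ corner v j → i ≡ j
corner-injective v 0F 0F _ = refl
corner-injective v 1F 1F _ = refl
corner-injective v 2F 2F _ = refl
corner-injective v 0F 1F ()
corner-injective v 0F 2F ()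
corner-injective v 1F 0F ()
corner-injective v 1F 2F ()
corner-injective v 2F 0F ()
corner-injective v 2F 1F ()

keep-injective : ∀ {m} {u w : Fin m} → _≡_ {A = Fin (suc (suc m))} (keep u) (keep w) → u ≡ w
keep-injective refl = refl

keep≡corner : ∀ {m} {u w : Fin m} j → keep u ≡ corner w j → u ≡ w
keep≡corner 0F e = keep-injective e
keep≡corner 1F ()
keep≡corner 2F ()

corner≢keep : ∀ {m} {v w : Fin m} → w ≢ v → ∀ i → corner v i ≢ keep w
corner≢keep w≢v 0F e = w≢v (sym (keep-injective e))
corner≢keep w≢v 1F ()
corner≢keep w≢v 2F ()

module _ (G : Graph) (v : Fin (n G)) (xs : Triple G) where
  E-keep-keep : ∀ {u w} → u ≢ v → w ≢ v → E (expandAt G v xs) (keep u) (keep w) ⇔ E G u w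
  E-keep-keep u≢v w≢v =
    mk⇔ proj₁ (λ e → e , (λ u≡v → ⊥-elim (u≢v u≡v)) , (λ w≡v → ⊥-elim (w≢v w≡v)))

  E-corner-keep : Neighbours G v xs → ∀ i {w} → w ≢ v → E (expandAt G v xs) (corner v i) (keep w) ⇔ (w ≡ xs i)
  E-corner-keep N 0F w≢v = mk⇔ (λ e → proj₁ (proj₂ e) refl)
                             (λ { refl → nbr-adjacent N 0F , (λ _ → refl) , (λ w≡v → ⊥-elim (w≢v w≡v)) })
  E-corner-keep N 1F w≢v = mk⇔ (λ { (inj₁ w≡v) → ⊥-elim (w≢v w≡v) ; (inj₂ e) → e }) inj₂
  E-corner-keep N 2F w≢v = mk⇔ (λ { (inj₁ w≡v) → ⊥-elim (w≢v w≡v) ; (inj₂ e) → e }) inj₂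

  E-keep-corner : Neighbours G v xs → Simple G → ∀ i {w} → w ≢ v →
                  E (expandAt G v xs) (keep w) (corner v i) ⇔ (w ≡ xs i)
  E-keep-corner N S 0F w≢v = mk⇔ (λ e → proj₂ (proj₂ e) refl)
                               (λ { refl → E-sym S (nbr-adjacent N 0F) , (λ w≡v → ⊥-elim (w≢v w≡v)) , (λ _ → refl) })
  E-keep-corner N S 1F w≢v = mk⇔ (λ { (inj₁ w≡v) → ⊥-elim (w≢v w≡v) ; (inj₂ e) → e }) inj₂
  E-keep-corner N S 2F w≢v = mk⇔ (λ { (inj₁ w≡v) → ⊥-elim (w≢v w≡v) ; (inj₂ e) → e }) inj₂

  E-corner-corner : Simple G → ∀ i j → E (expandAt G v xs) (corner v i) (corner v j) ⇔ (i ≢ j)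
  E-corner-corner S 0F 0F = mk⇔ (λ e → ⊥-elim (E-irrefl S v (proj₁ e))) (λ i≢i → ⊥-elim (i≢i refl))
  E-corner-corner S 0F 1F = mk⇔ (λ _ ()) (λ _ → inj₁ refl)
  E-corner-corner S 0F 2F = mk⇔ (λ _ ()) (λ _ → inj₁ refl)
  E-corner-corner S 1F 0F = mk⇔ (λ _ ()) (λ _ → inj₁ refl)
  E-corner-corner S 1F 1F = mk⇔ (λ ()) (λ i≢i → i≢i refl)
  E-corner-corner S 1F 2F = mk⇔ (λ _ ()) (λ _ → tt)
  E-corner-corner S 2F 0F = mk⇔ (λ _ ()) (λ _ → inj₁ refl)
  E-corner-corner S 2F 1F = mk⇔ (λ _ ()) (λ _ → tt)
  E-corner-corner S 2F 2F = mk⇔ (λ ()) (λ i≢i → i≢i refl)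

expandAt-simple : ∀ {G} → Simple G → ∀ v xs → Simple (expandAt G v xs)
expandAt-simple {G} S v xs = record { E-sym = λ {u} {w} → sym′ u w ; E-irrefl = irrefl }
  where
  sym′ : ∀ u w → E (expandAt G v xs) u w → E (expandAt G v xs) w u
  sym′ zero (suc zero) _ = tt
  sym′ (suc zero) zero _ = tt
  sym′ zero (keep w) e = e
  sym′ (keep w) zero e = e
  sym′ (suc zero) (keep w) e = e
  sym′ (keep w) (suc zero) e = e
  sym′ (keep u) (keep w) (e , f , g) = E-sym S e , g , f
  irrefl : ∀ u → ¬ E (expandAt G v xs) u u
  irrefl (keep u) (e , _) = E-irrefl S u e

K₄-simple : Simple K₄
K₄-simple = record { E-sym = λ u≢w w≡u → u≢w (sym w≡u) ; E-irrefl = λ u u≢u → u≢u refl }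

record _≃_ (G H : Graph) : Set where
  field
    fwd : Fin (n G) → Fin (n H)
    bwd : Fin (n H) → Fin (n G)
    fwd-bwd : ∀ a → fwd (bwd a) ≡ a
    bwd-fwd : ∀ p → bwd (fwd p) ≡ p
    fwd-E : ∀ p q → E G p q ⇔ E H (fwd p) (fwd q)
open _≃_ public

module _ {G H : Graph} (φ : G ≃ H) where
  fwd-injective : ∀ {p q} → fwd φ p ≡ fwd φ q → p ≡ q
  fwd-injective {p} {q} e = trans (sym (bwd-fwd φ p)) (trans (cong (bwd φ) e) (bwd-fwd φ q))

  bwd-injective : ∀ {a b} → bwd φ a ≡ bwd φ b → a ≡ b
  bwd-injective {a} {b} e = trans (sym (fwd-bwd φ a)) (trans (cong (fwd φ) e) (fwd-bwd φ b))

  bwd-unique : ∀ {p a} → fwd φ p ≡ a → bwd φ a ≡ p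
  bwd-unique {p} refl = bwd-fwd φ p

  bwd-E : ∀ a b → E H a b ⇔ E G (bwd φ a) (bwd φ b)
  bwd-E a b = E-resp-≡ H (sym (fwd-bwd φ a)) (sym (fwd-bwd φ b)) ⟨⇔⟩ ⇔.sym (fwd-E φ (bwd φ a) (bwd φ b))

≅⇒≃ : ∀ {G H} → G ≅ H → G ≃ H
≅⇒≃ (f , f-E) = record
  { fwd = Inverse.to f ; bwd = Inverse.from f
  ; fwd-bwd = Inverse.strictlyInverseˡ f ; bwd-fwd = Inverse.strictlyInverseʳ f ; fwd-E = f-E }

≃⇒≅ : ∀ {G H} → G ≃ H → G ≅ H
≃⇒≅ φ = mk↔ₛ′ (fwd φ) (bwd φ) (fwd-bwd φ) (bwd-fwd φ) , fwd-E φ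

≃-refl : ∀ {G} → G ≃ G
≃-refl = record
  { fwd = λ a → a ; bwd = λ a → a ; fwd-bwd = λ _ → refl ; bwd-fwd = λ _ → refl ; fwd-E = λ _ _ → ⇔.refl }

≃-sym : ∀ {G H} → G ≃ H → H ≃ G
≃-sym φ = record { fwd = bwd φ ; bwd = fwd φ ; fwd-bwd = bwd-fwd φ ; bwd-fwd = fwd-bwd φ ; fwd-E = bwd-E φ }

≃-trans : ∀ {G H K} → G ≃ H → H ≃ K → G ≃ K
≃-trans φ ψ = record
  { fwd = λ p → fwd ψ (fwd φ p) ; bwd = λ a → bwd φ (bwd ψ a)
  ; fwd-bwd = λ a → trans (cong (fwd ψ) (fwd-bwd φ (bwd ψ a))) (fwd-bwd ψ a)
  ; bwd-fwd = λ p → trans (cong (bwd φ) (bwd-fwd ψ (fwd φ p))) (bwd-fwd φ p)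
  ; fwd-E = λ p q → fwd-E φ p q ⟨⇔⟩ fwd-E ψ (fwd φ p) (fwd φ q) }

simple-≃ : ∀ {G H} → G ≃ H → Simple H → Simple G
simple-≃ φ S = record
  { E-sym = λ {u} {w} e → from (fwd-E φ w u) (E-sym S (to (fwd-E φ u w) e))
  ; E-irrefl = λ u e → E-irrefl S (fwd φ u) (to (fwd-E φ u u) e) }

neighbours-≃ : ∀ {G H v xs} (φ : G ≃ H) → Neighbours G v xs → Neighbours H (fwd φ v) (λ i → fwd φ (xs i))
neighbours-≃ {G} {H} {v} {xs} φ N = record
  { nbr-injective = λ i j e → nbr-injective N i j (fwd-injective φ e)
  ; nbr-adjacent = λ i → to (fwd-E φ v (xs i)) (nbr-adjacent N i)
  ; nbr-complete = complete }
  where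
  complete : ∀ y → E H (fwd φ v) y → ∃[ i ] y ≡ fwd φ (xs i)
  complete y e with nbr-complete N (bwd φ y) (subst (λ z → E G z (bwd φ y)) (bwd-fwd φ v) (to (bwd-E φ _ y) e))
  ... | i , y≡xsi = i , trans (sym (fwd-bwd φ y)) (cong (fwd φ) y≡xsi)

module IsoOntoExpansion (G′ G : Graph) (SG′ : Simple G′) (v : Fin (n G)) (xs : Triple G)
  (N : Neighbours G v xs) (SG : Simple G)
  (f : Fin (n G′) → Fin (suc (suc (n G)))) (g : Fin (suc (suc (n G))) → Fin (n G′))
  (f∘g : ∀ a → f (g a) ≡ a) (g∘f : ∀ p → g (f p) ≡ p)
  (keep-keep : ∀ u w → u ≢ v → w ≢ v → E G′ (g (keep u)) (g (keep w)) ⇔ E G u w)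
  (corner-keep : ∀ i w → w ≢ v → E G′ (g (corner v i)) (g (keep w)) ⇔ (w ≡ xs i))
  (corner-corner : ∀ i j → E G′ (g (corner v i)) (g (corner v j)) ⇔ (i ≢ j)) where

  private
    G^v = expandAt G v xs

    g-E : ∀ a b → E G′ (g a) (g b) ⇔ E G^v a b
    g-E a b with position v a | position v b
    ... | old u u≢v | old w w≢v = keep-keep u w u≢v w≢v ⟨⇔⟩ ⇔.sym (E-keep-keep G v xs u≢v w≢v)
    ... | new i | old w w≢v = corner-keep i w w≢v ⟨⇔⟩ ⇔.sym (E-corner-keep G v xs N i w≢v)
    ... | old u u≢v | new j =
      E-sym⇔ SG′ _ _ ⟨⇔⟩ corner-keep j u u≢v ⟨⇔⟩ ⇔.sym (E-keep-corner G v xs N SG j u≢v)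
    ... | new i | new j = corner-corner i j ⟨⇔⟩ ⇔.sym (E-corner-corner G v xs SG i j)

  iso : G′ ≃ G^v
  iso = record
    { fwd = f ; bwd = g ; fwd-bwd = f∘g ; bwd-fwd = g∘f
    ; fwd-E = λ p q → subst₂ (λ x y → E G′ x y ⇔ E G^v (f p) (f q)) (g∘f p) (g∘f q) (g-E (f p) (f q)) }

record ExpansionTransport {G H : Graph} (φ : G ≃ H) (v : Fin (n G)) (xs : Triple G)
                          (v′ : Fin (n H)) : Set where
  field
    iso        : expandAt G v xs ≃ expandAt H v′ (λ i → fwd φ (xs i))
    neighbours : Neighbours H v′ (λ i → fwd φ (xs i))
    iso-corner : ∀ i → fwd iso (corner v i) ≡ corner v′ i
    iso-keep   : ∀ u → fwd iso (keep u) ≡ keep (fwd φ u)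

transport-expansion : ∀ {G H} (φ : G ≃ H) {v xs} → Neighbours G v xs → Simple G → Simple H →
                      ∀ {v′} → fwd φ v ≡ v′ → ExpansionTransport φ v xs v′
transport-expansion {G} {H} φ {v} {xs} N SG SH refl = record
  { iso = IsoOntoExpansion.iso G^v H (expandAt-simple SG v xs) (fwd φ v) xs′ (neighbours-≃ φ N) SH
            f g f∘g g∘f keep-keep corner-keep corner-corner
  ; neighbours = neighbours-≃ φ N
  ; iso-corner = λ { 0F → refl ; 1F → refl ; 2F → refl }
  ; iso-keep = λ _ → refl }
  where
  G^v = expandAt G v xs
  xs′ : Triple H
  xs′ i = fwd φ (xs i)
  f : Fin (n G^v) → Fin (suc (suc (n H)))
  f zero = zero
  f (suc zero) = suc zero
  f (keep u) = keep (fwd φ u)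
  g : Fin (suc (suc (n H))) → Fin (n G^v)
  g zero = zero
  g (suc zero) = suc zero
  g (keep a) = keep (bwd φ a)
  f∘g : ∀ a → f (g a) ≡ a
  f∘g zero = refl
  f∘g (suc zero) = refl
  f∘g (keep a) = cong keep (fwd-bwd φ a)
  g∘f : ∀ a → g (f a) ≡ a
  g∘f zero = refl
  g∘f (suc zero) = refl
  g∘f (keep a) = cong keep (bwd-fwd φ a)
  g-corner : ∀ i → g (corner (fwd φ v) i) ≡ corner v i
  g-corner 0F = cong keep (bwd-fwd φ v)
  g-corner 1F = refl
  g-corner 2F = refl
  bwd≢v : ∀ {a} → a ≢ fwd φ v → bwd φ a ≢ v
  bwd≢v {a} a≢ e = a≢ (trans (sym (fwd-bwd φ a)) (cong (fwd φ) e))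
  bwd≡⇔ : ∀ {a} i → (bwd φ a ≡ xs i) ⇔ (a ≡ xs′ i)
  bwd≡⇔ {a} i = mk⇔ (λ e → trans (sym (fwd-bwd φ a)) (cong (fwd φ) e)) (λ e → bwd-unique φ (sym e))
  keep-keep : ∀ a b → a ≢ fwd φ v → b ≢ fwd φ v → E G^v (g (keep a)) (g (keep b)) ⇔ E H a b
  keep-keep a b a≢ b≢ = E-keep-keep G v xs (bwd≢v a≢) (bwd≢v b≢) ⟨⇔⟩ ⇔.sym (bwd-E φ a b)
  corner-keep : ∀ i b → b ≢ fwd φ v → E G^v (g (corner (fwd φ v) i)) (g (keep b)) ⇔ (b ≡ xs′ i)
  corner-keep i b b≢ = E-resp-≡ G^v (g-corner i) refl ⟨⇔⟩ E-corner-keep G v xs N i (bwd≢v b≢) ⟨⇔⟩ bwd≡⇔ i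
  corner-corner : ∀ i j → E G^v (g (corner (fwd φ v) i)) (g (corner (fwd φ v) j)) ⇔ (i ≢ j)
  corner-corner i j = E-resp-≡ G^v (g-corner i) (g-corner j) ⟨⇔⟩ E-corner-corner G v xs SG i j

module ReorderNeighbours {G : Graph} (SG : Simple G) {v : Fin (n G)} {ys cs : Triple G}
                         (Ny : Neighbours G v ys) (Nc : Neighbours G v cs) where
  private
    π : Fin 3 → Fin 3
    π i = proj₁ (nbr-complete Ny (cs i) (nbr-adjacent Nc i))
    cs≡ys∘π : ∀ i → cs i ≡ ys (π i)
    cs≡ys∘π i = proj₂ (nbr-complete Ny (cs i) (nbr-adjacent Nc i))

  reindex : Fin 3 → Fin 3
  reindex k = proj₁ (nbr-complete Nc (ys k) (nbr-adjacent Ny k))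

  private
    ys≡cs∘reindex : ∀ k → ys k ≡ cs (reindex k)
    ys≡cs∘reindex k = proj₂ (nbr-complete Nc (ys k) (nbr-adjacent Ny k))
    π∘reindex : ∀ k → π (reindex k) ≡ k
    π∘reindex k = nbr-injective Ny _ _ (sym (trans (ys≡cs∘reindex k) (cs≡ys∘π (reindex k))))
    reindex∘π : ∀ i → reindex (π i) ≡ i
    reindex∘π i = nbr-injective Nc _ _ (sym (trans (cs≡ys∘π i) (ys≡cs∘reindex (π i))))

    G^v = expandAt G v ys

    relabel : (Fin 3 → Fin 3) → Fin (suc (suc (n G))) → Fin (suc (suc (n G)))
    relabel σ zero = corner v (σ 1F)
    relabel σ (suc zero) = corner v (σ 2F)
    relabel σ (keep u) with u ≟ v
    ... | yes _ = corner v (σ 0F)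
    ... | no _ = keep u

    relabel-corner : ∀ σ i → relabel σ (corner v i) ≡ corner v (σ i)
    relabel-corner σ 0F with v ≟ v
    ... | yes _ = refl
    ... | no v≢v = ⊥-elim (v≢v refl)
    relabel-corner σ 1F = refl
    relabel-corner σ 2F = refl

    relabel-keep : ∀ σ u → u ≢ v → relabel σ (keep u) ≡ keep u
    relabel-keep σ u u≢v with u ≟ v
    ... | yes u≡v = ⊥-elim (u≢v u≡v)
    ... | no _ = refl

    relabel-inverse : ∀ σ τ → (∀ i → σ (τ i) ≡ i) → ∀ a → relabel σ (relabel τ a) ≡ a
    relabel-inverse σ τ σ∘τ a with position v a
    ... | old u u≢v = trans (cong (relabel σ) (relabel-keep τ u u≢v)) (relabel-keep σ u u≢v)
    ... | new i = trans (cong (relabel σ) (relabel-corner τ i))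
                        (trans (relabel-corner σ (τ i)) (cong (corner v) (σ∘τ i)))

    keep-keep : ∀ u w → u ≢ v → w ≢ v → E G^v (relabel π (keep u)) (relabel π (keep w)) ⇔ E G u w
    keep-keep u w u≢v w≢v =
      E-resp-≡ G^v (relabel-keep π u u≢v) (relabel-keep π w w≢v) ⟨⇔⟩ E-keep-keep G v ys u≢v w≢v

    corner-keep : ∀ i w → w ≢ v → E G^v (relabel π (corner v i)) (relabel π (keep w)) ⇔ (w ≡ cs i)
    corner-keep i w w≢v = E-resp-≡ G^v (relabel-corner π i) (relabel-keep π w w≢v)
      ⟨⇔⟩ E-corner-keep G v ys Ny (π i) w≢v
      ⟨⇔⟩ mk⇔ (λ e → trans e (sym (cs≡ys∘π i))) (λ e → trans e (cs≡ys∘π i))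

    corner-corner : ∀ i j → E G^v (relabel π (corner v i)) (relabel π (corner v j)) ⇔ (i ≢ j)
    corner-corner i j = E-resp-≡ G^v (relabel-corner π i) (relabel-corner π j)
      ⟨⇔⟩ E-corner-corner G v ys SG (π i) (π j)
      ⟨⇔⟩ mk⇔ (λ πi≢πj i≡j → πi≢πj (cong π i≡j))
              (λ i≢j πi≡πj → i≢j (trans (sym (reindex∘π i)) (trans (cong reindex πi≡πj) (reindex∘π j))))

  iso : expandAt G v ys ≃ expandAt G v cs
  iso = IsoOntoExpansion.iso G^v G (expandAt-simple SG v ys) v cs Nc SG (relabel reindex) (relabel π)
          (relabel-inverse reindex π reindex∘π) (relabel-inverse π reindex π∘reindex)
          keep-keep corner-keep corner-corner

  iso-corner : ∀ i → fwd iso (corner v i) ≡ corner v (reindex i)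
  iso-corner = relabel-corner reindex

  iso-keep : ∀ u → u ≢ v → fwd iso (keep u) ≡ keep u
  iso-keep = relabel-keep reindex

record ExpansionIsomorphism {G H : Graph} (φ : G ≃ H) (v : Fin (n G)) (xs : Triple G)
                            (v′ : Fin (n H)) (cs : Triple H) : Set where
  field
    iso        : expandAt G v xs ≃ expandAt H v′ cs
    reindex    : Fin 3 → Fin 3
    iso-corner : ∀ i → fwd iso (corner v i) ≡ corner v′ (reindex i)
    iso-keep   : ∀ u → fwd φ u ≢ v′ → fwd iso (keep u) ≡ keep (fwd φ u)

  reindex-injective : ∀ {i j} → reindex i ≡ reindex j → i ≡ j
  reindex-injective {i} {j} e = corner-injective v i j
    (fwd-injective iso (trans (iso-corner i) (trans (cong (corner v′) e) (sym (iso-corner j)))))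

expansion-≃ : ∀ {G H} (φ : G ≃ H) → Simple G → Simple H → ∀ {v xs} → Neighbours G v xs →
              ∀ {v′ cs} → fwd φ v ≡ v′ → Neighbours H v′ cs → ExpansionIsomorphism φ v xs v′ cs
expansion-≃ φ SG SH Nx φv≡v′ Nc = record
  { iso = ≃-trans T.iso R.iso
  ; reindex = R.reindex
  ; iso-corner = λ i → trans (cong (fwd R.iso) (T.iso-corner i)) (R.iso-corner i)
  ; iso-keep = λ u φu≢v′ → trans (cong (fwd R.iso) (T.iso-keep u)) (R.iso-keep (fwd φ u) φu≢v′) }
  where
  module T = ExpansionTransport (transport-expansion φ Nx SG SH φv≡v′)
  module R = ReorderNeighbours SH T.neighbours Nc

contract : ∀ {m} → Fin m → Fin (suc (suc m)) → Fin m
contract v zero = v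
contract v (suc zero) = v
contract v (keep u) = u

contract-corner : ∀ {m} (v : Fin m) i → contract v (corner v i) ≡ v
contract-corner v 0F = refl
contract-corner v 1F = refl
contract-corner v 2F = refl

-- (G^v)^w ≃ (G^w)^v: zs contracts the triangle of v back to v, and xs′ replaces
-- the neighbour w of v by the corner of the triangle of w that faces v.
module CommuteExpansions {G : Graph} (SG : Simple G) {v : Fin (n G)} {xs : Triple G}
    (Nx : Neighbours G v xs) {w : Fin (n G)} (w≢v : w ≢ v)
    {ys : Triple (expandAt G v xs)} (Ny : Neighbours (expandAt G v xs) (keep w) ys) where
  private
    G^v = expandAt G v xs
    v≢w : v ≢ w
    v≢w v≡w = w≢v (sym v≡w)
    corner-keep-w : ∀ i → E G^v (keep w) (corner v i) ⇔ (w ≡ xs i)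
    corner-keep-w i = E-keep-corner G v xs Nx SG i w≢v

  zs : Triple G
  zs i = contract v (ys i)

  zs-neighbours : Neighbours G w zs
  zs-neighbours = record { nbr-injective = injective ; nbr-adjacent = adjacent ; nbr-complete = complete }
    where
    adjacent : ∀ i → E G w (zs i)
    adjacent i with ys i | position v (ys i) | nbr-adjacent Ny i
    ... | ._ | old u u≢v | e = to (E-keep-keep G v xs w≢v u≢v) e
    ... | ._ | new k | e rewrite contract-corner v k =
      E-sym SG (subst (E G v) (sym (to (corner-keep-w k) e)) (nbr-adjacent Nx k))
    injective : ∀ i j → zs i ≡ zs j → i ≡ j
    injective i j e with ys i | position v (ys i) | ys j | position v (ys j)
                       | nbr-injective Ny i j | nbr-adjacent Ny i | nbr-adjacent Ny j
    ... | ._ | old u u≢v | ._ | old _ _ | inj | _ | _ = inj (cong keep e)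
    ... | ._ | old u u≢v | ._ | new k | _ | _ | _ = ⊥-elim (u≢v (trans e (contract-corner v k)))
    ... | ._ | new k | ._ | old t t≢v | _ | _ | _ = ⊥-elim (t≢v (trans (sym e) (contract-corner v k)))
    ... | ._ | new k | ._ | new l | inj | eᵢ | eⱼ =
      inj (cong (corner v) (nbr-injective Nx k l (trans (sym (to (corner-keep-w k) eᵢ)) (to (corner-keep-w l) eⱼ))))
    complete : ∀ y → E G w y → ∃[ i ] y ≡ zs i
    complete y e with y ≟ v
    ... | yes refl =
      let (k , w≡xsk) = nbr-complete Nx w (E-sym SG e)
          (i , cornerk≡ysi) = nbr-complete Ny (corner v k) (from (corner-keep-w k) w≡xsk)
      in i , trans (sym (contract-corner v k)) (cong (contract v) cornerk≡ysi)
    ... | no y≢v =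
      let (i , keepy≡ysi) = nbr-complete Ny (keep y) (from (E-keep-keep G v xs w≢v y≢v) e)
      in i , cong (contract v) keepy≡ysi

  private
    G^w = expandAt G w zs

    corner-towards-w : ∀ i → xs i ≡ w → ∃[ j ] corner v i ≡ ys j
    corner-towards-w i xsi≡w = nbr-complete Ny (corner v i) (from (corner-keep-w i) (sym xsi≡w))

    xs′-at : ∀ i → Dec (xs i ≡ w) → Fin (n G^w)
    xs′-at i (yes xsi≡w) = corner w (proj₁ (corner-towards-w i xsi≡w))
    xs′-at i (no _) = keep (xs i)

  xs′ : Triple G^w
  xs′ i = xs′-at i (xs i ≟ w)

  private
    corner-w-adjacent : ∀ j → E G^w (keep v) (corner w j) ⇔ (v ≡ zs j)
    corner-w-adjacent j = E-keep-corner G w zs zs-neighbours SG j v≢w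

    xs′-keep : ∀ {u} i → u ≢ w → (u ≡ xs i) ⇔ (keep u ≡ xs′ i)
    xs′-keep {u} i u≢w with xs i ≟ w
    ... | yes xsi≡w = mk⇔ (λ u≡xsi → ⊥-elim (u≢w (trans u≡xsi xsi≡w)))
                          (λ e → ⊥-elim (u≢w (keep≡corner (proj₁ (corner-towards-w i xsi≡w)) e)))
    ... | no _ = mk⇔ (cong keep) keep-injective

    xs′-corner : ∀ {i j} → xs i ≡ w → corner v i ≡ ys j → corner w j ≡ xs′ i
    xs′-corner {i} {j} xsi≡w cornervi≡ysj with xs i ≟ w
    ... | yes p = cong (corner w) (nbr-injective Ny j _ (trans (sym cornervi≡ysj) (proj₂ (corner-towards-w i p))))
    ... | no xsi≢w = ⊥-elim (xsi≢w xsi≡w)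

  xs′-neighbours : Neighbours G^w (keep v) xs′
  xs′-neighbours = record { nbr-injective = injective ; nbr-adjacent = adjacent ; nbr-complete = complete }
    where
    adjacent : ∀ i → E G^w (keep v) (xs′ i)
    adjacent i with xs i ≟ w
    ... | yes xsi≡w = let (j , cornervi≡ysj) = corner-towards-w i xsi≡w in
      from (corner-w-adjacent j) (trans (sym (contract-corner v i)) (cong (contract v) cornervi≡ysj))
    ... | no xsi≢w = from (E-keep-keep G w zs v≢w xsi≢w) (nbr-adjacent Nx i)
    injective : ∀ i k → xs′ i ≡ xs′ k → i ≡ k
    injective i k e with xs i ≟ w | xs k ≟ w
    ... | yes p | yes q = nbr-injective Nx i k (trans p (sym q))
    ... | yes p | no q = ⊥-elim (q (keep≡corner (proj₁ (corner-towards-w i p)) (sym e)))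
    ... | no p | yes q = ⊥-elim (p (keep≡corner (proj₁ (corner-towards-w k q)) e))
    ... | no p | no q = nbr-injective Nx i k (keep-injective e)
    complete-corner : ∀ j → v ≡ zs j → ∀ a → Position v a → ys j ≡ a → ∃[ i ] corner w j ≡ xs′ i
    complete-corner j v≡zsj ._ (old u u≢v) ysj≡u = ⊥-elim (u≢v (sym (trans v≡zsj (cong (contract v) ysj≡u))))
    complete-corner j v≡zsj ._ (new k) ysj≡cornervk =
      k , xs′-corner (sym (to (corner-keep-w k) (subst (E G^v (keep w)) ysj≡cornervk (nbr-adjacent Ny j))))
                     (sym ysj≡cornervk)
    complete : ∀ y → E G^w (keep v) y → ∃[ i ] y ≡ xs′ i
    complete y e with position w y
    ... | old u u≢w = let (i , u≡xsi) = nbr-complete Nx u (to (E-keep-keep G w zs v≢w u≢w) e)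
                      in i , to (xs′-keep i u≢w) u≡xsi
    ... | new j = complete-corner j (to (corner-w-adjacent j) e) (ys j) (position v (ys j)) refl

  private
    A = expandAt G^v (keep w) ys
    B = expandAt G^w (keep v) xs′

    SA : Simple A
    SA = expandAt-simple (expandAt-simple SG v xs) (keep w) ys

    swap : Fin (n A) → Fin (n B)
    swap zero = keep zero
    swap (suc zero) = keep (suc zero)
    swap (keep zero) = zero
    swap (keep (suc zero)) = suc zero
    swap (keep (keep u)) = keep (keep u)

    swap-involutive : ∀ a → swap (swap a) ≡ a
    swap-involutive zero = refl
    swap-involutive (suc zero) = refl
    swap-involutive (keep zero) = refl
    swap-involutive (keep (suc zero)) = refl
    swap-involutive (keep (keep u)) = refl

    swap-corner-v : ∀ i → swap (corner (keep v) i) ≡ keep (corner v i)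
    swap-corner-v 0F = refl
    swap-corner-v 1F = refl
    swap-corner-v 2F = refl

    swap-corner-w : ∀ j → swap (keep (corner w j)) ≡ corner (keep w) j
    swap-corner-w 0F = refl
    swap-corner-w 1F = refl
    swap-corner-w 2F = refl

    keep≡ys⇔ : ∀ {u} j → u ≢ v → (keep u ≡ ys j) ⇔ (u ≡ zs j)
    keep≡ys⇔ {u} j u≢v = mk⇔ (cong (contract v)) (λ e → lift (ys j) (position v (ys j)) refl e)
      where
      lift : ∀ a → Position v a → ys j ≡ a → u ≡ contract v (ys j) → keep u ≡ ys j
      lift ._ (old t _) ysj≡t e = trans (cong keep (trans e (cong (contract v) ysj≡t))) (sym ysj≡t)
      lift ._ (new k) ysj≡cornervk e = ⊥-elim (u≢v (trans e (trans (cong (contract v) ysj≡cornervk) (contract-corner v k))))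

    unkeep≢ : ∀ {u : Fin (n G)} → _≢_ {A = Fin (n G^w)} (keep u) (keep v) → u ≢ v
    unkeep≢ ne e = ne (cong keep e)

    keep≢keep : ∀ {u : Fin (n G)} → u ≢ w → _≢_ {A = Fin (n G^v)} (keep u) (keep w)
    keep≢keep u≢w e = u≢w (keep-injective e)

    corner-w-keep : ∀ j u → u ≢ w → u ≢ v → E A (corner (keep w) j) (keep (keep u)) ⇔ E G^w (corner w j) (keep u)
    corner-w-keep j u u≢w u≢v = E-corner-keep G^v (keep w) ys Ny j (keep≢keep u≢w) ⟨⇔⟩ keep≡ys⇔ j u≢v
                                ⟨⇔⟩ ⇔.sym (E-corner-keep G w zs zs-neighbours j u≢w)

    keep-keep : ∀ a b → a ≢ keep v → b ≢ keep v → E A (swap (keep a)) (swap (keep b)) ⇔ E G^w a b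
    keep-keep a b a≢ b≢ with position w a | position w b
    ... | old u u≢w | old t t≢w =
      E-keep-keep G^v (keep w) ys (keep≢keep u≢w) (keep≢keep t≢w)
      ⟨⇔⟩ E-keep-keep G v xs (unkeep≢ a≢) (unkeep≢ b≢)
      ⟨⇔⟩ ⇔.sym (E-keep-keep G w zs u≢w t≢w)
    ... | new j | old t t≢w = E-resp-≡ A (swap-corner-w j) refl ⟨⇔⟩ corner-w-keep j t t≢w (unkeep≢ b≢)
    ... | old u u≢w | new j = E-resp-≡ A refl (swap-corner-w j) ⟨⇔⟩ E-sym⇔ SA _ _
      ⟨⇔⟩ corner-w-keep j u u≢w (unkeep≢ a≢) ⟨⇔⟩ E-sym⇔ (expandAt-simple SG w zs) _ _
    ... | new j | new k = E-resp-≡ A (swap-corner-w j) (swap-corner-w k)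
      ⟨⇔⟩ E-corner-corner G^v (keep w) ys (expandAt-simple SG v xs) j k ⟨⇔⟩ ⇔.sym (E-corner-corner G w zs SG j k)

    corner-keep : ∀ i b → b ≢ keep v → E A (swap (corner (keep v) i)) (swap (keep b)) ⇔ (b ≡ xs′ i)
    corner-keep i b b≢ with position w b
    ... | old u u≢w = E-resp-≡ A (swap-corner-v i) refl
      ⟨⇔⟩ E-keep-keep G^v (keep w) ys (corner≢keep w≢v i) (keep≢keep u≢w)
      ⟨⇔⟩ E-corner-keep G v xs Nx i (unkeep≢ b≢) ⟨⇔⟩ xs′-keep i u≢w
    ... | new j = E-resp-≡ A (swap-corner-v i) (swap-corner-w j)
      ⟨⇔⟩ E-keep-corner G^v (keep w) ys Ny (expandAt-simple SG v xs) j (corner≢keep w≢v i) ⟨⇔⟩ corner-matches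
      where
      corner-matches : (corner v i ≡ ys j) ⇔ (corner w j ≡ xs′ i)
      corner-matches with xs i ≟ w
      ... | yes xsi≡w = let (j′ , cornervi≡ysj′) = corner-towards-w i xsi≡w in
        mk⇔ (λ cornervi≡ysj → cong (corner w) (nbr-injective Ny j j′ (trans (sym cornervi≡ysj) cornervi≡ysj′)))
            (λ e → trans cornervi≡ysj′ (cong ys (sym (corner-injective w _ _ e))))
      ... | no xsi≢w = mk⇔ (λ cornervi≡ysj → ⊥-elim (xsi≢w (sym (to (corner-keep-w i)
                                (subst (E G^v (keep w)) (sym cornervi≡ysj) (nbr-adjacent Ny j))))))
                           (λ e → ⊥-elim (xsi≢w (keep≡corner j (sym e))))

    corner-corner : ∀ i j → E A (swap (corner (keep v) i)) (swap (corner (keep v) j)) ⇔ (i ≢ j)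
    corner-corner i j = E-resp-≡ A (swap-corner-v i) (swap-corner-v j)
      ⟨⇔⟩ E-keep-keep G^v (keep w) ys (corner≢keep w≢v i) (corner≢keep w≢v j) ⟨⇔⟩ E-corner-corner G v xs SG i j

  iso : A ≃ B
  iso = IsoOntoExpansion.iso A G^w SA (keep v) xs′ xs′-neighbours (expandAt-simple SG w zs)
          swap swap swap-involutive swap-involutive keep-keep corner-keep corner-corner

  iso-corner-w : ∀ j → fwd iso (corner (keep w) j) ≡ keep (corner w j)
  iso-corner-w 0F = refl
  iso-corner-w 1F = refl
  iso-corner-w 2F = refl

  iso-keep-corner-v : ∀ i → fwd iso (keep (corner v i)) ≡ corner (keep v) i
  iso-keep-corner-v 0F = refl
  iso-keep-corner-v 1F = refl
  iso-keep-corner-v 2F = refl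

record CommutedExpansion {S G : Graph} {v : Fin (n G)} {ws : Triple G} (φ : S ≃ expandAt G v ws)
                         (t : Fin (n S)) (xs : Triple S) (w : Fin (n G)) : Set where
  field
    zs              : Triple G
    zs-neighbours   : Neighbours G w zs
    xs′             : Triple (expandAt G w zs)
    xs′-neighbours  : Neighbours (expandAt G w zs) (keep v) xs′
    iso             : expandAt S t xs ≃ expandAt (expandAt G w zs) (keep v) xs′
    iso-corner      : ∀ i → fwd iso (corner t i) ≡ keep (corner w i)
    iso-keep-keep   : ∀ {p x} → fwd φ p ≡ keep x → fwd iso (keep p) ≡ keep (keep x)
    iso-keep-corner : ∀ {p i} → fwd φ p ≡ corner v i → fwd iso (keep p) ≡ corner (keep v) i

-- Opaque: its uses need only the fields, and unfolding them makes type
-- checking very slow.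
opaque
  commute-expansions : ∀ {S G v ws} (φ : S ≃ expandAt G v ws) → Simple G → Neighbours G v ws →
                       ∀ {t w} → fwd φ t ≡ keep w → w ≢ v → ∀ {xs} → Neighbours S t xs →
                       CommutedExpansion {ws = ws} φ t xs w
  commute-expansions {S} {G} {v} {ws} φ SG Nws φt≡w w≢v Nxs = record
    { zs = C.zs ; zs-neighbours = C.zs-neighbours ; xs′ = C.xs′ ; xs′-neighbours = C.xs′-neighbours
    ; iso = ≃-trans T.iso C.iso
    ; iso-corner = λ i → trans (cong (fwd C.iso) (T.iso-corner i)) (C.iso-corner-w i)
    ; iso-keep-keep = λ {p} φp≡x → cong (fwd C.iso) (trans (T.iso-keep p) (cong keep φp≡x))
    ; iso-keep-corner = λ {p} {i} φp≡corner →
        trans (cong (fwd C.iso) (trans (T.iso-keep p) (cong keep φp≡corner))) (C.iso-keep-corner-v i) }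
    where
    SG^v : Simple (expandAt G v ws)
    SG^v = expandAt-simple SG v ws
    module T = ExpansionTransport (transport-expansion φ Nxs (simple-≃ φ SG^v) SG^v φt≡w)
    module C = CommuteExpansions SG Nws w≢v T.neighbours

triple : ∀ {A : Set} → A → A → A → Fin 3 → A
triple a b c 0F = a
triple a b c 1F = b
triple a b c 2F = c

record Expansion (H G : Graph) : Set where
  constructor expansion
  field
    {centre}   : Fin (n H)
    {nbrs}     : Triple H
    neighbours : Neighbours H centre nbrs
    iso        : G ≃ expandAt H centre nbrs

isExpansion⇒Expansion : ∀ {H G} → IsExpansion H G → Expansion H G
isExpansion⇒Expansion {H} (v , x₁ , x₂ , x₃ , x₁≢x₂ , x₁≢x₃ , x₂≢x₃ , e₁ , e₂ , e₃ , complete , φ) =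
  expansion (record { nbr-injective = injective ; nbr-adjacent = adjacent ; nbr-complete = complete′ }) (≅⇒≃ φ)
  where
  xs = triple x₁ x₂ x₃
  injective : ∀ i j → xs i ≡ xs j → i ≡ j
  injective 0F 0F _ = refl
  injective 0F 1F e = ⊥-elim (x₁≢x₂ e)
  injective 0F 2F e = ⊥-elim (x₁≢x₃ e)
  injective 1F 0F e = ⊥-elim (x₁≢x₂ (sym e))
  injective 1F 1F _ = refl
  injective 1F 2F e = ⊥-elim (x₂≢x₃ e)
  injective 2F 0F e = ⊥-elim (x₁≢x₃ (sym e))
  injective 2F 1F e = ⊥-elim (x₂≢x₃ (sym e))
  injective 2F 2F _ = refl
  adjacent : ∀ i → E H v (xs i)
  adjacent 0F = e₁
  adjacent 1F = e₂
  adjacent 2F = e₃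
  complete′ : ∀ y → E H v y → ∃[ i ] y ≡ xs i
  complete′ y e with complete y e
  ... | inj₁ y≡x₁ = 0F , y≡x₁
  ... | inj₂ (inj₁ y≡x₂) = 1F , y≡x₂
  ... | inj₂ (inj₂ y≡x₃) = 2F , y≡x₃

Expansion⇒IsExpansion : ∀ {H G} → Expansion H G → IsExpansion H G
Expansion⇒IsExpansion {H} (expansion {v} {xs} N φ) =
  v , xs 0F , xs 1F , xs 2F , (λ e → 0≢1 (nbr-injective N 0F 1F e)) , (λ e → 0≢2 (nbr-injective N 0F 2F e)) ,
  (λ e → 1≢2 (nbr-injective N 1F 2F e)) , nbr-adjacent N 0F , nbr-adjacent N 1F , nbr-adjacent N 2F ,
  complete , ≃⇒≅ φ
  where
  0≢1 : 0F ≢ 1F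
  0≢1 ()
  0≢2 : 0F ≢ 2F
  0≢2 ()
  1≢2 : 1F ≢ 2F
  1≢2 ()
  complete : ∀ y → E H v y → (y ≡ xs 0F) ⊎ (y ≡ xs 1F) ⊎ (y ≡ xs 2F)
  complete y e with nbr-complete N y e
  ... | 0F , y≡x₀ = inj₁ y≡x₀
  ... | 1F , y≡x₁ = inj₂ (inj₁ y≡x₁)
  ... | 2F , y≡x₂ = inj₂ (inj₂ y≡x₂)

expansion-≃ˡ : ∀ {H G G′} → G′ ≃ G → Expansion H G → Expansion H G′
expansion-≃ˡ ψ (expansion N φ) = expansion N (≃-trans ψ φ)

klee-simple : ∀ {G} → Klee G → Simple G
klee-simple (base φ) = simple-≃ (≅⇒≃ φ) K₄-simple
klee-simple (step k e) with isExpansion⇒Expansion e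
... | expansion {v} {xs} _ φ = simple-≃ φ (expandAt-simple (klee-simple k) v xs)

FromTricorn : Graph → Set₁
FromTricorn G = (G ≅ tricorn) ⊎ Descendant tricorn G

fromTricorn-≃ : ∀ {G G′} → G′ ≃ G → FromTricorn G → FromTricorn G′
fromTricorn-≃ ψ (inj₁ φ) = inj₁ (≃⇒≅ (≃-trans ψ (≅⇒≃ {H = tricorn} φ)))
fromTricorn-≃ ψ (inj₂ (one e)) = inj₂ (one (Expansion⇒IsExpansion (expansion-≃ˡ ψ (isExpansion⇒Expansion e))))
fromTricorn-≃ ψ (inj₂ (more d e)) = inj₂ (more d (Expansion⇒IsExpansion (expansion-≃ˡ ψ (isExpansion⇒Expansion e))))

fromTricorn-expand : ∀ {H G} → Simple H → FromTricorn H → Expansion H G → FromTricorn G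
fromTricorn-expand SH (inj₁ φ) (expansion N ψ) = inj₂ (one (Expansion⇒IsExpansion
  (expansion (ExpansionTransport.neighbours T) (≃-trans ψ (ExpansionTransport.iso T)))))
  where
  φ′ = ≅⇒≃ {H = tricorn} φ
  T = transport-expansion φ′ N SH (simple-≃ (≃-sym φ′) SH) refl
fromTricorn-expand SH (inj₂ d) e = inj₂ (more d (Expansion⇒IsExpansion e))

-- Small graphs, checked by evaluation

DecidableE : Graph → Set
DecidableE G = ∀ a b → Dec (E G a b)

K₄-decidable : DecidableE K₄
K₄-decidable a b = ¬? (a ≟ b)

tricorn-decidable : DecidableE tricorn
tricorn-decidable a b =
  ((suc (toℕ a) , suc (toℕ b)) ∈? tricornEdges) ⊎-dec ((suc (toℕ b) , suc (toℕ a)) ∈? tricornEdges)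

expandAt-decidable : ∀ {G} → DecidableE G → ∀ v xs → DecidableE (expandAt G v xs)
expandAt-decidable E? v xs zero zero = no (λ ())
expandAt-decidable E? v xs zero (suc zero) = yes tt
expandAt-decidable E? v xs (suc zero) zero = yes tt
expandAt-decidable E? v xs (suc zero) (suc zero) = no (λ ())
expandAt-decidable E? v xs zero (keep w) = w ≟ v ⊎-dec w ≟ xs 1F
expandAt-decidable E? v xs (keep w) zero = w ≟ v ⊎-dec w ≟ xs 1F
expandAt-decidable E? v xs (suc zero) (keep w) = w ≟ v ⊎-dec w ≟ xs 2F
expandAt-decidable E? v xs (keep w) (suc zero) = w ≟ v ⊎-dec w ≟ xs 2F
expandAt-decidable E? v xs (keep u) (keep w) = E? u w ×-dec (u ≟ v →-dec w ≟ xs 0F) ×-dec (w ≟ v →-dec u ≟ xs 0F)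

_⇔-dec_ : ∀ {A B : Set} → Dec A → Dec B → Dec (A ⇔ B)
a? ⇔-dec b? = map′ (uncurry mk⇔) (λ a⇔b → to a⇔b , from a⇔b) ((a? →-dec b?) ×-dec (b? →-dec a?))

neighbours? : ∀ {G} → DecidableE G → ∀ v xs → Dec (Neighbours G v xs)
neighbours? E? v xs = map′
  (λ (inj , adj , compl) → record { nbr-injective = inj ; nbr-adjacent = adj ; nbr-complete = compl })
  (λ N → nbr-injective N , nbr-adjacent N , nbr-complete N)
  ((all? λ i → all? λ j → xs i ≟ xs j →-dec i ≟ j) ×-dec (all? λ i → E? v (xs i))
   ×-dec (all? λ y → E? v y →-dec any? λ i → y ≟ xs i))

IsIsomorphism : (G H : Graph) → (Fin (n G) → Fin (n H)) → (Fin (n H) → Fin (n G)) → Set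
IsIsomorphism G H f g = (∀ a → f (g a) ≡ a) × (∀ p → g (f p) ≡ p) × (∀ p q → E G p q ⇔ E H (f p) (f q))

isomorphism? : ∀ {G H} → DecidableE G → DecidableE H → ∀ f g → Dec (IsIsomorphism G H f g)
isomorphism? E?G E?H f g = (all? λ a → f (g a) ≟ a) ×-dec (all? λ p → g (f p) ≟ p)
                           ×-dec (all? λ p → all? λ q → E?G p q ⇔-dec E?H (f p) (f q))

mk≃ : ∀ {G H} f g → IsIsomorphism G H f g → G ≃ H
mk≃ f g (f∘g , g∘f , f-E) = record { fwd = f ; bwd = g ; fwd-bwd = f∘g ; bwd-fwd = g∘f ; fwd-E = f-E }

-- Junk value: zero where f misses a; isomorphism? rejects such an inverse.
invert : ∀ {m k} → (Fin (suc m) → Fin k) → Fin k → Fin (suc m)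
invert f a with any? (λ p → f p ≟ a)
... | yes (p , _) = p
... | no _ = zero

-- Padded with v itself when v has fewer than three neighbours.
sortedNeighbours : ∀ {G} → DecidableE G → Fin (n G) → Triple G
sortedNeighbours E? v i = Maybe.fromMaybe v (List.head (List.drop (toℕ i) (List.filter (E? v) (List.allFin _))))

K₄-nbrs : Fin 4 → Triple K₄
K₄-nbrs = sortedNeighbours K₄-decidable

prism : Graph
prism = expandAt K₄ 0F (K₄-nbrs 0F)

prism′ : Graph
prism′ = expandAt K₄ 1F (K₄-nbrs 1F)

prism-decidable : DecidableE prism
prism-decidable = expandAt-decidable K₄-decidable 0F (K₄-nbrs 0F)

prism′-decidable : DecidableE prism′
prism′-decidable = expandAt-decidable K₄-decidable 1F (K₄-nbrs 1F)

prism-simple : Simple prism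
prism-simple = expandAt-simple K₄-simple 0F (K₄-nbrs 0F)

prism-nbrs : Fin 6 → Triple prism
prism-nbrs = sortedNeighbours prism-decidable

prism-at-corner : Fin 3 → Graph
prism-at-corner i = expandAt prism (corner 0F i) (prism-nbrs (corner 0F i))

prism-at-corner-decidable : ∀ i → DecidableE (prism-at-corner i)
prism-at-corner-decidable i = expandAt-decidable prism-decidable (corner 0F i) (prism-nbrs (corner 0F i))

prism-at-corner-simple : ∀ i → Simple (prism-at-corner i)
prism-at-corner-simple i = expandAt-simple prism-simple (corner 0F i) (prism-nbrs (corner 0F i))

prism-at-corner-nbrs : ∀ i → Fin 8 → Triple (prism-at-corner i)
prism-at-corner-nbrs i = sortedNeighbours (prism-at-corner-decidable i)

prism-at-corners : Fin 3 → Fin 3 → Graph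
prism-at-corners i j = expandAt (prism-at-corner i) (keep (corner 0F j)) (prism-at-corner-nbrs i (keep (corner 0F j)))

prism-at-corners-decidable : ∀ i j → DecidableE (prism-at-corners i j)
prism-at-corners-decidable i j =
  expandAt-decidable (prism-at-corner-decidable i) (keep (corner 0F j)) (prism-at-corner-nbrs i (keep (corner 0F j)))

-- Sends the far triangle keep (K₄-nbrs 0F k) of prism to the corners
-- corner 1F k of prism′.
prism-table : Fin 6 → Fin 6
prism-table = lookup (4F ∷ 5F ∷ 2F ∷ 3F ∷ 0F ∷ 1F ∷ [])

-- The entries for i ≡ j are never used.
tricorn-table : Fin 3 → Fin 3 → Fin 10 → Fin 10
tricorn-table 0F 1F = lookup (4F ∷ 5F ∷ 3F ∷ 8F ∷ 1F ∷ 0F ∷ 9F ∷ 7F ∷ 6F ∷ 2F ∷ [])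
tricorn-table 0F 2F = lookup (1F ∷ 4F ∷ 6F ∷ 7F ∷ 0F ∷ 5F ∷ 2F ∷ 8F ∷ 3F ∷ 9F ∷ [])
tricorn-table 1F 0F = lookup (1F ∷ 4F ∷ 6F ∷ 7F ∷ 2F ∷ 0F ∷ 5F ∷ 9F ∷ 8F ∷ 3F ∷ [])
tricorn-table 1F 2F = lookup (1F ∷ 4F ∷ 2F ∷ 7F ∷ 6F ∷ 5F ∷ 0F ∷ 3F ∷ 8F ∷ 9F ∷ [])
tricorn-table 2F 0F = lookup (1F ∷ 4F ∷ 6F ∷ 7F ∷ 0F ∷ 2F ∷ 5F ∷ 9F ∷ 3F ∷ 8F ∷ [])
tricorn-table 2F 1F = lookup (1F ∷ 4F ∷ 2F ∷ 7F ∷ 5F ∷ 6F ∷ 0F ∷ 3F ∷ 9F ∷ 8F ∷ [])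
tricorn-table _ _ = λ a → a

-- Facts about the small graphs above, decided by evaluation. They are opaque
-- so that later type checking never unfolds their proofs.
opaque
  prism-neighbours : Neighbours K₄ 0F (K₄-nbrs 0F)
  prism-neighbours = toWitness {a? = neighbours? K₄-decidable 0F (K₄-nbrs 0F)} _

  prism′-neighbours : Neighbours K₄ 1F (K₄-nbrs 1F)
  prism′-neighbours = toWitness {a? = neighbours? K₄-decidable 1F (K₄-nbrs 1F)} _

  prism-at-corner-neighbours : ∀ i → Neighbours prism (corner 0F i) (prism-nbrs (corner 0F i))
  prism-at-corner-neighbours = toWitness {a? = all? λ i →
    neighbours? prism-decidable (corner 0F i) (prism-nbrs (corner 0F i))} _

  prism-at-corners-neighbours : ∀ i j → i ≢ j →
    Neighbours (prism-at-corner i) (keep (corner 0F j)) (prism-at-corner-nbrs i (keep (corner 0F j)))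
  prism-at-corners-neighbours = toWitness {a? = all? λ i → all? λ j → ¬? (i ≟ j) →-dec
    neighbours? (prism-at-corner-decidable i) (keep (corner 0F j)) (prism-at-corner-nbrs i (keep (corner 0F j)))} _

  prism-table-isomorphism : IsIsomorphism prism prism′ prism-table (invert prism-table)
  prism-table-isomorphism = toWitness {a? = isomorphism? prism-decidable prism′-decidable prism-table (invert prism-table)} _

  tricorn-table-isomorphism : ∀ i j → i ≢ j →
    IsIsomorphism (prism-at-corners i j) tricorn (tricorn-table i j) (invert (tricorn-table i j))
  tricorn-table-isomorphism = toWitness {a? = all? λ i → all? λ j → ¬? (i ≟ j) →-dec
    isomorphism? (prism-at-corners-decidable i j) tricorn-decidable (tricorn-table i j) (invert (tricorn-table i j))} _

prism≃prism′ : prism ≃ prism′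
prism≃prism′ = mk≃ prism-table (invert prism-table) prism-table-isomorphism

prism-at-corners≃tricorn : ∀ i j → i ≢ j → prism-at-corners i j ≃ tricorn
prism-at-corners≃tricorn i j i≢j = mk≃ (tricorn-table i j) (invert (tricorn-table i j)) (tricorn-table-isomorphism i j i≢j)

K₄-automorphism : Permutation′ 4 → K₄ ≃ K₄
K₄-automorphism π = record
  { fwd = π ⟨$⟩ʳ_ ; bwd = π ⟨$⟩ˡ_ ; fwd-bwd = λ _ → inverseʳ π ; bwd-fwd = λ _ → inverseˡ π
  ; fwd-E = λ u w → mk⇔
      (λ u≢w πu≡πw → u≢w (trans (sym (inverseˡ π)) (trans (cong (π ⟨$⟩ˡ_) πu≡πw) (inverseˡ π))))
      (λ πu≢πw u≡w → πu≢πw (cong (π ⟨$⟩ʳ_) u≡w)) }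

K₄-vertex-transitive : ∀ c → Σ (K₄ ≃ K₄) λ σ → fwd σ c ≡ 0F
K₄-vertex-transitive c = K₄-automorphism (transpose c 0F) , transpose-c
  where
  transpose-c : transpose c 0F ⟨$⟩ʳ c ≡ 0F
  transpose-c rewrite dec-true (c ≟ c) refl = refl

prism-form : ∀ {H} → H ≃ K₄ → Simple H → ∀ {w xs} → Neighbours H w xs →
             Σ (H ≃ K₄) λ φ → ExpansionIsomorphism φ w xs 0F (K₄-nbrs 0F)
prism-form f SH {w} N = φ , expansion-≃ φ SH K₄-simple N (proj₂ σ) prism-neighbours
  where
  σ = K₄-vertex-transitive (fwd f w)
  φ = ≃-trans f (proj₁ σ)

-- Vertices untouched since the initial K₄

data Survivor : (G : Graph) → Fin (n G) → Set₁ where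
  initial  : ∀ {G} → G ≃ K₄ → ∀ t → Survivor G t
  expanded : ∀ {H G t v xs} → Survivor H t → Neighbours H v xs → v ≢ t →
             (φ : G ≃ expandAt H v xs) → Survivor G (bwd φ (keep t))

survivor-simple : ∀ {G t} → Survivor G t → Simple G
survivor-simple (initial φ _) = simple-≃ φ K₄-simple
survivor-simple (expanded {v = v} {xs} S N _ φ) = simple-≃ φ (expandAt-simple (survivor-simple S) v xs)

survivor-≃ : ∀ {G G′ t} (ψ : G′ ≃ G) → Survivor G t → Survivor G′ (bwd ψ t)
survivor-≃ ψ (initial φ t) = initial (≃-trans ψ φ) (bwd ψ t)
survivor-≃ ψ (expanded S N v≢t φ) = expanded S N v≢t (≃-trans ψ φ)

-- prism≃prism′ sends the corners of the triangle of prism to the untouched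
-- vertices 0, 2, 3 of prism′ (that is, of K₄ expanded at 1).
prism-corner-survivor : ∀ k → Survivor prism (corner 0F k)
prism-corner-survivor 0F = survivor-≃ prism≃prism′ (expanded (initial ≃-refl 0F) prism′-neighbours (λ ()) ≃-refl)
prism-corner-survivor 1F = survivor-≃ prism≃prism′ (expanded (initial ≃-refl 2F) prism′-neighbours (λ ()) ≃-refl)
prism-corner-survivor 2F = survivor-≃ prism≃prism′ (expanded (initial ≃-refl 3F) prism′-neighbours (λ ()) ≃-refl)

corner-survivor : ∀ {H w xs} → Survivor H w → Neighbours H w xs → ∀ i → Survivor (expandAt H w xs) (corner w i)
corner-survivor S@(initial f _) N i =
  subst (Survivor _) (bwd-unique P.iso (P.iso-corner i)) (survivor-≃ P.iso (prism-corner-survivor (P.reindex i)))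
  where module P = ExpansionIsomorphism (proj₂ (prism-form f (survivor-simple S) N))
corner-survivor (expanded {t = t₀} {v} S₀ N₀ v≢t₀ φ) N i =
  subst (Survivor _) (bwd-unique C.iso (C.iso-corner i))
    (survivor-≃ C.iso (expanded (corner-survivor S₀ C.zs-neighbours i) C.xs′-neighbours
                                (λ e → corner≢keep v≢t₀ i (sym e)) ≃-refl))
  where
  module C = CommutedExpansion (commute-expansions φ (survivor-simple S₀) N₀ (fwd-bwd φ (keep t₀))
                                                  (λ e → v≢t₀ (sym e)) N)

klee-survivor : ∀ {G} → Klee G → ∀ t → Survivor G t
klee-survivor (base φ) t = initial (≅⇒≃ φ) t
klee-survivor {G} (step k e) t with isExpansion⇒Expansion e
... | expansion {w} N φ = from-position (fwd φ t) (position w (fwd φ t)) refl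
  where
  from-position : ∀ a → Position w a → fwd φ t ≡ a → Survivor G t
  from-position ._ (old u u≢w) φt≡u =
    subst (Survivor G) (bwd-unique φ φt≡u) (expanded (klee-survivor k u) N (λ e → u≢w (sym e)) φ)
  from-position ._ (new i) φt≡corner =
    subst (Survivor G) (bwd-unique φ φt≡corner) (survivor-≃ φ (corner-survivor (klee-survivor k w) N i))

two-corners-of-K₄-expansion :
  ∀ {S} → S ≃ K₄ → Simple S → ∀ {t xs} → Neighbours S t xs → ∀ {i j} → i ≢ j →
  ∀ {ys} → Neighbours (expandAt S t xs) (corner t i) ys →
  ∀ {zs} → Neighbours (expandAt (expandAt S t xs) (corner t i) ys) (keep (corner t j)) zs →
  expandAt (expandAt (expandAt S t xs) (corner t i) ys) (keep (corner t j)) zs ≃ tricorn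
two-corners-of-K₄-expansion {S} f SS {t} {xs} N₁ {i} {j} i≢j {ys} N₂ N₃ =
  ≃-trans R.iso (prism-at-corners≃tricorn i′ j′ i′≢j′)
  where
  SS^t = expandAt-simple SS t xs
  module P = ExpansionIsomorphism (proj₂ (prism-form f SS N₁))
  i′ = P.reindex i
  j′ = P.reindex j
  i′≢j′ : i′ ≢ j′
  i′≢j′ e = i≢j (P.reindex-injective e)
  module Q = ExpansionIsomorphism (expansion-≃ P.iso SS^t prism-simple N₂ (P.iso-corner i) (prism-at-corner-neighbours i′))
  Q-corner-j : fwd Q.iso (keep (corner t j)) ≡ keep (corner 0F j′)
  Q-corner-j = trans
    (Q.iso-keep (corner t j) (λ e → i′≢j′ (sym (corner-injective 0F j′ i′ (trans (sym (P.iso-corner j)) e)))))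
    (cong keep (P.iso-corner j))
  module R = ExpansionIsomorphism (expansion-≃ Q.iso (expandAt-simple SS^t (corner t i) ys) (prism-at-corner-simple i′)
                                                N₃ Q-corner-j (prism-at-corners-neighbours i′ j′ i′≢j′))

-- By induction on the survivor: the three expansions commute past the one
-- that produced S, down to the case S ≃ K₄.
two-corners-from-tricorn :
  ∀ {S t} → Survivor S t → ∀ {xs} → Neighbours S t xs → ∀ {i j} → i ≢ j →
  ∀ {ys} → Neighbours (expandAt S t xs) (corner t i) ys →
  ∀ {zs} → Neighbours (expandAt (expandAt S t xs) (corner t i) ys) (keep (corner t j)) zs →
  FromTricorn (expandAt (expandAt (expandAt S t xs) (corner t i) ys) (keep (corner t j)) zs)
two-corners-from-tricorn Sv@(initial f _) N₁ i≢j N₂ N₃ =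
  inj₁ (≃⇒≅ (two-corners-of-K₄-expansion f (survivor-simple Sv) N₁ i≢j N₂ N₃))
two-corners-from-tricorn (expanded {t = t₀} {v} S₀ N₀ v≢t₀ φ) N₁ {i} {j} i≢j N₂ N₃ =
  fromTricorn-≃ C₃.iso (fromTricorn-expand SK₃ IH (expansion C₃.xs′-neighbours ≃-refl))
  where
  SH₀ = survivor-simple S₀
  module C₁ = CommutedExpansion (commute-expansions φ SH₀ N₀ (fwd-bwd φ (keep t₀)) (λ e → v≢t₀ (sym e)) N₁)
  SK₁ = expandAt-simple SH₀ t₀ C₁.zs
  module C₂ = CommutedExpansion (commute-expansions C₁.iso SK₁ C₁.xs′-neighbours (C₁.iso-corner i)
                                                    (corner≢keep v≢t₀ i) N₂)
  SK₂ = expandAt-simple SK₁ (corner t₀ i) C₂.zs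
  module C₃ = CommutedExpansion (commute-expansions C₂.iso SK₂ C₂.xs′-neighbours (C₂.iso-keep-keep (C₁.iso-corner j))
                                                    (λ e → corner≢keep v≢t₀ j (keep-injective e)) N₃)
  SK₃ = expandAt-simple SK₂ (keep (corner t₀ j)) C₃.zs
  IH = two-corners-from-tricorn S₀ C₁.zs-neighbours i≢j C₂.zs-neighbours C₃.zs-neighbours

_∈₃_ : ∀ {A : Set} → A → (Fin 3 → A) → Set
x ∈₃ e = ∃[ i ] x ≡ e i

_∈₃?_ : ∀ {m} (x : Fin m) e → Dec (x ∈₃ e)
x ∈₃? e = any? λ i → x ≟ e i

Within : ∀ {A : Set} → (Fin 3 → A) → A → A → A → Set
Within e p q r = p ∈₃ e × q ∈₃ e × r ∈₃ e

opaque
  distinct-cover-Fin3 : ∀ (a b c k : Fin 3) → a ≢ b → a ≢ c → b ≢ c → k ≡ a ⊎ k ≡ b ⊎ k ≡ c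
  distinct-cover-Fin3 = toWitness {a? = all? λ a → all? λ b → all? λ c → all? λ k →
    ¬? (a ≟ b) →-dec ¬? (a ≟ c) →-dec ¬? (b ≟ c) →-dec (k ≟ a ⊎-dec k ≟ b ⊎-dec k ≟ c)} _

distinct-cover-image : ∀ {A : Set} {e : Fin 3 → A} {x y z} → x ∈₃ e → y ∈₃ e → z ∈₃ e →
                       x ≢ y → x ≢ z → y ≢ z → ∀ k → e k ≡ x ⊎ e k ≡ y ⊎ e k ≡ z
distinct-cover-image {e = e} (i , x≡eᵢ) (j , y≡eⱼ) (l , z≡eₗ) x≢y x≢z y≢z k
  with distinct-cover-Fin3 i j l k (λ i≡j → x≢y (trans x≡eᵢ (trans (cong e i≡j) (sym y≡eⱼ))))
                                 (λ i≡l → x≢z (trans x≡eᵢ (trans (cong e i≡l) (sym z≡eₗ))))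
                                 (λ j≡l → y≢z (trans y≡eⱼ (trans (cong e j≡l) (sym z≡eₗ))))
... | inj₁ k≡i = inj₁ (trans (cong e k≡i) (sym x≡eᵢ))
... | inj₂ (inj₁ k≡j) = inj₂ (inj₁ (trans (cong e k≡j) (sym y≡eⱼ)))
... | inj₂ (inj₂ k≡l) = inj₂ (inj₂ (trans (cong e k≡l) (sym z≡eₗ)))

data KeptTriangle (G : Graph) (u : Fin (n G)) : (p q r : Fin (suc (suc (n G)))) → Set where
  kept : ∀ {p q r} → p ≢ u → q ≢ u → r ≢ u → E G p q → E G q r → E G p r →
         KeptTriangle G u (keep p) (keep q) (keep r)

module _ {G : Graph} (SG : Simple G) {u : Fin (n G)} {xs : Triple G} (N : Neighbours G u xs) where
  private
    G′ = expandAt G u xs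
    SG′ = expandAt-simple SG u xs

    two-corners-one-kept : ∀ {i j w} → E G′ (corner u i) (keep w) → E G′ (corner u j) (keep w) →
                           E G′ (corner u i) (corner u j) → w ≢ u → ⊥
    two-corners-one-kept {i} {j} eᵢ eⱼ eᵢⱼ w≢u = to (E-corner-corner G u xs SG i j) eᵢⱼ
      (nbr-injective N i j (trans (sym (to (E-corner-keep G u xs N i w≢u) eᵢ)) (to (E-corner-keep G u xs N j w≢u) eⱼ)))

    one-corner-two-kept : ∀ {i w z} → E G′ (corner u i) (keep w) → E G′ (corner u i) (keep z) →
                          E G′ (keep w) (keep z) → w ≢ u → z ≢ u → ⊥
    one-corner-two-kept {i} {w} {z} e-w e-z e-wz w≢u z≢u = E-irrefl SG′ (keep z)
      (subst (λ x → E G′ (keep x) (keep z))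
             (trans (to (E-corner-keep G u xs N i w≢u) e-w) (sym (to (E-corner-keep G u xs N i z≢u) e-z))) e-wz)

  triangle-in-expansion : ∀ p q r → E G′ p q → E G′ q r → E G′ p r →
                          Within (corner u) p q r ⊎ KeptTriangle G u p q r
  triangle-in-expansion p q r pq qr pr with position u p | position u q | position u r
  ... | old a a≢u | old b b≢u | old c c≢u = inj₂ (kept a≢u b≢u c≢u
        (to (E-keep-keep G u xs a≢u b≢u) pq) (to (E-keep-keep G u xs b≢u c≢u) qr) (to (E-keep-keep G u xs a≢u c≢u) pr))
  ... | new i | new j | new k = inj₁ ((i , refl) , (j , refl) , (k , refl))
  ... | new i | new j | old w w≢u = ⊥-elim (two-corners-one-kept pr qr pq w≢u)
  ... | new i | old w w≢u | new j = ⊥-elim (two-corners-one-kept pq (E-sym SG′ qr) pr w≢u)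
  ... | old w w≢u | new i | new j = ⊥-elim (two-corners-one-kept (E-sym SG′ pq) (E-sym SG′ pr) qr w≢u)
  ... | new i | old w w≢u | old z z≢u = ⊥-elim (one-corner-two-kept pq pr qr w≢u z≢u)
  ... | old w w≢u | new i | old z z≢u = ⊥-elim (one-corner-two-kept (E-sym SG′ pq) qr pr w≢u z≢u)
  ... | old w w≢u | old z z≢u | new i = ⊥-elim (one-corner-two-kept (E-sym SG′ pr) (E-sym SG′ qr) pq w≢u z≢u)

module SortedTriple {m} {e : Fin 3 → Fin m} {a b c : Fin m} (a<b : a Fin.< b) (b<c : b Fin.< c)
                    (abc∈ : Within e a b c) where
  private
    a<c : a Fin.< c
    a<c = FinP.<-trans a<b b<c
    a∈ = proj₁ abc∈
    b∈ = proj₁ (proj₂ abc∈)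
    c∈ = proj₂ (proj₂ abc∈)

  member : ∀ {x} → x ∈₃ e → x ≡ a ⊎ x ≡ b ⊎ x ≡ c
  member (k , refl) = distinct-cover-image a∈ b∈ c∈ (FinP.<⇒≢ a<b) (FinP.<⇒≢ a<c) (FinP.<⇒≢ b<c) k

  least : ∀ {x} → x ∈₃ e → a Fin.≤ x
  least x∈ with member x∈
  ... | inj₁ refl = FinP.≤-refl
  ... | inj₂ (inj₁ refl) = ℕP.<⇒≤ a<b
  ... | inj₂ (inj₂ refl) = ℕP.<⇒≤ a<c

  greatest : ∀ {x} → x ∈₃ e → x Fin.≤ c
  greatest x∈ with member x∈
  ... | inj₁ refl = ℕP.<⇒≤ a<c
  ... | inj₂ (inj₁ refl) = ℕP.<⇒≤ b<c
  ... | inj₂ (inj₂ refl) = FinP.≤-refl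

sorted-within-unique : ∀ {m} {e : Fin 3 → Fin m} {a b c a′ b′ c′} →
  a Fin.< b → b Fin.< c → a′ Fin.< b′ → b′ Fin.< c′ → Within e a b c → Within e a′ b′ c′ →
  (a , b , c) ≡ (a′ , b′ , c′)
sorted-within-unique a<b b<c a′<b′ b′<c′ W@(a∈ , b∈ , c∈) W′@(a′∈ , b′∈ , c′∈)
  with FinP.≤-antisym (S.least a′∈) (S′.least a∈) | FinP.≤-antisym (S′.greatest c∈) (S.greatest c′∈)
     | S.member b′∈
  where
  module S = SortedTriple a<b b<c W
  module S′ = SortedTriple a′<b′ b′<c′ W′
... | refl | refl | inj₁ refl = ⊥-elim (FinP.<⇒≢ a′<b′ refl)
... | refl | refl | inj₂ (inj₁ refl) = refl
... | refl | refl | inj₂ (inj₂ refl) = ⊥-elim (FinP.<⇒≢ b′<c′ refl)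

-- Path-like Klee graphs

record NewTriangle (G : Graph) (e : Triple G) : Set₁ where
  field
    {parent}    : Graph
    parent-klee : Klee parent
    centre      : Fin (n parent)
    {nbrs}      : Triple parent
    neighbours  : Neighbours parent centre nbrs
    iso         : G ≃ expandAt parent centre nbrs
    iso-corner  : ∀ k → fwd iso (e k) ≡ corner centre k

  simple : Simple G
  simple = simple-≃ iso (expandAt-simple (klee-simple parent-klee) centre nbrs)

  injective : ∀ {i j} → e i ≡ e j → i ≡ j
  injective {i} {j} eᵢ≡eⱼ =
    corner-injective centre i j (trans (sym (iso-corner i)) (trans (cong (fwd iso) eᵢ≡eⱼ) (iso-corner j)))

newTriangle-≃ : ∀ {G G′ e} (ψ : G′ ≃ G) → NewTriangle G e → NewTriangle G′ (λ k → bwd ψ (e k))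
newTriangle-≃ {e = e} ψ T = record
  { parent-klee = parent-klee ; centre = centre ; neighbours = neighbours ; iso = ≃-trans ψ iso
  ; iso-corner = λ k → trans (cong (fwd iso) (fwd-bwd ψ (e k))) (iso-corner k) }
  where open NewTriangle T

-- The NewTriangle witnesses are what lets expand-inner be re-established
-- after a vertex of an end triangle is expanded.
record PathLike (G : Graph) : Set₁ where
  field
    end₁ end₂       : Triple G
    end₁-new        : NewTriangle G end₁
    end₂-new        : NewTriangle G end₂
    ends-disjoint   : ∀ i j → end₁ i ≢ end₂ j
    triangle-at-end : ∀ p q r → E G p q → E G q r → E G p r → Within end₁ p q r ⊎ Within end₂ p q r
    expand-inner    : ∀ v → ¬ v ∈₃ end₁ → ¬ v ∈₃ end₂ → ∀ {xs} → Neighbours G v xs →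
                      FromTricorn (expandAt G v xs)

  simple : Simple G
  simple = NewTriangle.simple end₁-new
open PathLike

pathLike-swap : ∀ {G} → PathLike G → PathLike G
pathLike-swap P = record
  { end₁ = end₂ P ; end₂ = end₁ P ; end₁-new = end₂-new P ; end₂-new = end₁-new P
  ; ends-disjoint = λ i j e → ends-disjoint P j i (sym e)
  ; triangle-at-end = λ p q r pq qr pr → Data.Sum.swap (triangle-at-end P p q r pq qr pr)
  ; expand-inner = λ v ∉₁ ∉₂ → expand-inner P v ∉₂ ∉₁ }
  where import Data.Sum

pathLike-≃ : ∀ {G G′} → G′ ≃ G → PathLike G → PathLike G′
pathLike-≃ {G} {G′} ψ P = record
  { end₁ = λ k → bwd ψ (end₁ P k) ; end₂ = λ k → bwd ψ (end₂ P k)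
  ; end₁-new = newTriangle-≃ ψ (end₁-new P) ; end₂-new = newTriangle-≃ ψ (end₂-new P)
  ; ends-disjoint = λ i j e → ends-disjoint P i j (bwd-injective ψ e)
  ; triangle-at-end = λ p q r pq qr pr → pull (triangle-at-end P (fwd ψ p) (fwd ψ q) (fwd ψ r)
                                          (to (fwd-E ψ p q) pq) (to (fwd-E ψ q r) qr) (to (fwd-E ψ p r) pr))
  ; expand-inner = λ v ∉₁ ∉₂ N → fromTricorn-≃ (ExpansionTransport.iso (T N))
      (expand-inner P (fwd ψ v) (λ ∈₁ → ∉₁ (pull-∈ ∈₁)) (λ ∈₂ → ∉₂ (pull-∈ ∈₂))
                    (ExpansionTransport.neighbours (T N))) }
  where
  SG′ = simple-≃ ψ (simple P)
  T : ∀ {v xs} → Neighbours G′ v xs → ExpansionTransport ψ v xs (fwd ψ v)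
  T N = transport-expansion ψ N SG′ (simple P) refl
  pull-∈ : ∀ {e : Triple G} {p} → fwd ψ p ∈₃ e → p ∈₃ (λ k → bwd ψ (e k))
  pull-∈ (k , ψp≡eₖ) = k , sym (bwd-unique ψ ψp≡eₖ)
  pull : ∀ {p q r} →
         Within (end₁ P) (fwd ψ p) (fwd ψ q) (fwd ψ r) ⊎ Within (end₂ P) (fwd ψ p) (fwd ψ q) (fwd ψ r) →
         Within (λ k → bwd ψ (end₁ P k)) p q r ⊎ Within (λ k → bwd ψ (end₂ P k)) p q r
  pull (inj₁ (p∈ , q∈ , r∈)) = inj₁ (pull-∈ p∈ , pull-∈ q∈ , pull-∈ r∈)
  pull (inj₂ (p∈ , q∈ , r∈)) = inj₂ (pull-∈ p∈ , pull-∈ q∈ , pull-∈ r∈)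

prism-pathLike : PathLike prism
prism-pathLike = record
  { end₁ = corner 0F ; end₂ = λ k → keep (K₄-nbrs 0F k)
  ; end₁-new = record { parent-klee = K₄-klee ; centre = 0F ; neighbours = prism-neighbours
                      ; iso = ≃-refl ; iso-corner = λ _ → refl }
  ; end₂-new = record { parent-klee = K₄-klee ; centre = 1F ; neighbours = prism′-neighbours
                      ; iso = prism≃prism′ ; iso-corner = λ { 0F → refl ; 1F → refl ; 2F → refl } }
  ; ends-disjoint = disjoint
  ; triangle-at-end = triangle
  ; expand-inner = inner }
  where
  K₄-klee : Klee K₄
  K₄-klee = base (≃⇒≅ ≃-refl)
  K₄-nbr : ∀ u → u ≢ 0F → u ∈₃ K₄-nbrs 0F
  K₄-nbr u u≢0 = nbr-complete prism-neighbours u (λ 0≡u → u≢0 (sym 0≡u))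
  disjoint : ∀ i j → corner 0F i ≢ keep (K₄-nbrs 0F j)
  disjoint 0F j e = nbr≢centre prism-neighbours K₄-simple j (sym (keep-injective e))
  disjoint 1F j ()
  disjoint 2F j ()
  triangle : ∀ p q r → E prism p q → E prism q r → E prism p r →
             Within (corner 0F) p q r ⊎ Within (λ k → keep (K₄-nbrs 0F k)) p q r
  triangle p q r pq qr pr with triangle-in-expansion K₄-simple prism-neighbours p q r pq qr pr
  ... | inj₁ corners = inj₁ corners
  ... | inj₂ (kept p≢0 q≢0 r≢0 _ _ _) = inj₂ (lift (K₄-nbr _ p≢0) , lift (K₄-nbr _ q≢0) , lift (K₄-nbr _ r≢0))
    where
    lift : ∀ {x} → x ∈₃ K₄-nbrs 0F → keep x ∈₃ (λ k → keep (K₄-nbrs 0F k))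
    lift (k , x≡) = k , cong keep x≡
  inner : ∀ v → ¬ v ∈₃ corner 0F → ¬ v ∈₃ (λ k → keep (K₄-nbrs 0F k)) → ∀ {xs} → Neighbours prism v xs →
          FromTricorn (expandAt prism v xs)
  inner v ∉₁ ∉₂ _ with position 0F v
  ... | new i = ⊥-elim (∉₁ (i , refl))
  ... | old u u≢0 = ⊥-elim (∉₂ (let (k , u≡) = K₄-nbr u u≢0 in k , cong keep u≡))

K₄-expansion-pathLike : ∀ {H v xs} → H ≃ K₄ → Neighbours H v xs → PathLike (expandAt H v xs)
K₄-expansion-pathLike f N = pathLike-≃ (ExpansionIsomorphism.iso (proj₂ (prism-form f (simple-≃ f K₄-simple) N)))
                                      prism-pathLike

module ExpandEnd {H : Graph} (klee : Klee H) (P : PathLike H) {k₀ : Fin 3} {u : Fin (n H)} (u≡end : u ≡ end₁ P k₀)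
                 {xs : Triple H} (N : Neighbours H u xs) where
  private
    G = expandAt H u xs
    SH = simple P
    SG = expandAt-simple SH u xs

  new-end₁ : NewTriangle G (corner u)
  new-end₁ = record { parent-klee = klee ; centre = u ; neighbours = N ; iso = ≃-refl ; iso-corner = λ _ → refl }

  new-end₂ : NewTriangle G (λ k → keep (end₂ P k))
  new-end₂ = from-position (fwd T.iso u) (position T.centre (fwd T.iso u)) refl
    where
    module T = NewTriangle (end₂-new P)
    from-position : ∀ a → Position T.centre a → fwd T.iso u ≡ a → NewTriangle G (λ k → keep (end₂ P k))
    from-position ._ (new i) φu≡corner = ⊥-elim (ends-disjoint P k₀ i (trans (sym u≡end)
      (fwd-injective T.iso (trans φu≡corner (sym (T.iso-corner i))))))
    from-position ._ (old u₀ u₀≢t) φu≡u₀ = record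
      { parent-klee = step T.parent-klee (Expansion⇒IsExpansion (expansion C.zs-neighbours ≃-refl))
      ; centre = keep T.centre ; neighbours = C.xs′-neighbours ; iso = C.iso
      ; iso-corner = λ k → C.iso-keep-corner (T.iso-corner k) }
      where
      module C = CommutedExpansion (commute-expansions T.iso (klee-simple T.parent-klee) T.neighbours φu≡u₀ u₀≢t N)

  disjoint : ∀ i j → corner u i ≢ keep (end₂ P j)
  disjoint 0F j e = ends-disjoint P k₀ j (trans (sym u≡end) (keep-injective e))
  disjoint 1F j ()
  disjoint 2F j ()

  triangle : ∀ p q r → E G p q → E G q r → E G p r →
             Within (corner u) p q r ⊎ Within (λ k → keep (end₂ P k)) p q r
  triangle p q r pq qr pr with triangle-in-expansion SH N p q r pq qr pr
  ... | inj₁ corners = inj₁ corners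
  ... | inj₂ (kept p≢u q≢u r≢u pq′ qr′ pr′) with triangle-at-end P _ _ _ pq′ qr′ pr′
  ...   | inj₂ (p∈ , q∈ , r∈) = inj₂ (lift p∈ , lift q∈ , lift r∈)
    where
    lift : ∀ {x} → x ∈₃ end₂ P → keep x ∈₃ (λ k → keep (end₂ P k))
    lift (k , x≡) = k , cong keep x≡
  ...   | inj₁ (p∈ , q∈ , r∈)
    with distinct-cover-image p∈ q∈ r∈ (edge⇒≢ SH pq′) (edge⇒≢ SH pr′) (edge⇒≢ SH qr′) k₀
  ...     | inj₁ end≡p = ⊥-elim (p≢u (sym (trans u≡end end≡p)))
  ...     | inj₂ (inj₁ end≡q) = ⊥-elim (q≢u (sym (trans u≡end end≡q)))
  ...     | inj₂ (inj₂ end≡r) = ⊥-elim (r≢u (sym (trans u≡end end≡r)))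

  private
    inner-kept-off-end : ∀ v₀ → v₀ ≢ u → ¬ v₀ ∈₃ end₁ P → ¬ v₀ ∈₃ end₂ P → ∀ {zs} → Neighbours G (keep v₀) zs →
                         FromTricorn (expandAt G (keep v₀) zs)
    inner-kept-off-end v₀ v₀≢u ∉₁ ∉₂ N′ = fromTricorn-≃ C.iso
      (fromTricorn-expand (expandAt-simple SH v₀ C.zs) (expand-inner P v₀ ∉₁ ∉₂ C.zs-neighbours)
                          (expansion C.xs′-neighbours ≃-refl))
      where module C = CommuteExpansions SH N v₀≢u N′

    inner-second-corner : ∀ {k₁ v₀} → v₀ ≡ end₁ P k₁ → v₀ ≢ u → ∀ {zs} → Neighbours G (keep v₀) zs →
                          FromTricorn (expandAt G (keep v₀) zs)
    inner-second-corner {k₁} {v₀} v₀≡end v₀≢u N′ = fromTricorn-≃ L₂.iso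
      (two-corners-from-tricorn (klee-survivor T.parent-klee T.centre) T.neighbours k₀≢k₁ L₁.neighbours L₂.neighbours)
      where
      module T = NewTriangle (end₁-new P)
      S^t = expandAt-simple (klee-simple T.parent-klee) T.centre T.nbrs
      φu≡corner : fwd T.iso u ≡ corner T.centre k₀
      φu≡corner = trans (cong (fwd T.iso) u≡end) (T.iso-corner k₀)
      φv₀≡corner : fwd T.iso v₀ ≡ corner T.centre k₁
      φv₀≡corner = trans (cong (fwd T.iso) v₀≡end) (T.iso-corner k₁)
      k₀≢k₁ : k₀ ≢ k₁
      k₀≢k₁ k₀≡k₁ = v₀≢u (trans v₀≡end (trans (cong (end₁ P) (sym k₀≡k₁)) (sym u≡end)))
      module L₁ = ExpansionTransport (transport-expansion T.iso N SH S^t φu≡corner)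
      S^t^u = expandAt-simple S^t (corner T.centre k₀) (λ i → fwd T.iso (xs i))
      module L₂ = ExpansionTransport (transport-expansion L₁.iso N′ SG S^t^u (trans (L₁.iso-keep v₀) (cong keep φv₀≡corner)))

  inner : ∀ v → ¬ v ∈₃ corner u → ¬ v ∈₃ (λ k → keep (end₂ P k)) → ∀ {zs} → Neighbours G v zs →
          FromTricorn (expandAt G v zs)
  inner v ∉₁ ∉₂ N′ with position u v
  ... | new i = ⊥-elim (∉₁ (i , refl))
  ... | old v₀ v₀≢u with v₀ ∈₃? end₁ P
  ...   | yes (k₁ , v₀≡end) = inner-second-corner v₀≡end v₀≢u N′
  ...   | no ∉end₁ = inner-kept-off-end v₀ v₀≢u ∉end₁ (λ (k , v₀≡) → ∉₂ (k , cong keep v₀≡)) N′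

  pathLike : PathLike G
  pathLike = record
    { end₁ = corner u ; end₂ = λ k → keep (end₂ P k) ; end₁-new = new-end₁ ; end₂-new = new-end₂
    ; ends-disjoint = disjoint ; triangle-at-end = triangle ; expand-inner = inner }

klee-trichotomy : ∀ {G} → Klee G → (G ≃ K₄) ⊎ FromTricorn G ⊎ PathLike G
klee-trichotomy (base φ) = inj₁ (≅⇒≃ φ)
klee-trichotomy (step k e) with isExpansion⇒Expansion e | klee-trichotomy k
... | expansion N φ | inj₁ f = inj₂ (inj₂ (pathLike-≃ φ (K₄-expansion-pathLike f N)))
... | expansion N φ | inj₂ (inj₁ fromTricorn) =
  inj₂ (inj₁ (fromTricorn-expand (klee-simple k) fromTricorn (expansion N φ)))
... | expansion {v} N φ | inj₂ (inj₂ P) with v ∈₃? end₁ P | v ∈₃? end₂ P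
...   | yes (k₀ , v≡end) | _ = inj₂ (inj₂ (pathLike-≃ φ (ExpandEnd.pathLike k P v≡end N)))
...   | no _ | yes (k₀ , v≡end) = inj₂ (inj₂ (pathLike-≃ φ (ExpandEnd.pathLike k (pathLike-swap P) v≡end N)))
...   | no ∉₁ | no ∉₂ = inj₂ (inj₁ (fromTricorn-≃ φ (expand-inner P v ∉₁ ∉₂ N)))

at-most-two-triangles : ∀ {G} → PathLike G → ¬ HasThreeTriangles G
at-most-two-triangles {G} P (t₁ , t₂ , t₃ , t₁≢t₂ , t₁≢t₃ , t₂≢t₃) =
  pigeonhole (end-of t₁) (end-of t₂) (end-of t₃)
  where
  AtEnd : Triangle G → Set
  AtEnd ((a , b , c) , _) = Within (end₁ P) a b c ⊎ Within (end₂ P) a b c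
  end-of : ∀ t → AtEnd t
  end-of ((a , b , c) , _ , _ , ab , bc , ac) = triangle-at-end P a b c ab bc ac
  same : ∀ {e} (t t′ : Triangle G) → Within e _ _ _ → Within e _ _ _ → triVerts {G} t ≡ triVerts {G} t′
  same ((_ , _ , _) , a<b , b<c , _) ((_ , _ , _) , a′<b′ , b′<c′ , _) = sorted-within-unique a<b b<c a′<b′ b′<c′
  pigeonhole : AtEnd t₁ → AtEnd t₂ → AtEnd t₃ → ⊥
  pigeonhole (inj₁ w₁) (inj₁ w₂) _ = t₁≢t₂ (same t₁ t₂ w₁ w₂)
  pigeonhole (inj₂ w₁) (inj₂ w₂) _ = t₁≢t₂ (same t₁ t₂ w₁ w₂)
  pigeonhole (inj₁ w₁) _ (inj₁ w₃) = t₁≢t₃ (same t₁ t₃ w₁ w₃)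
  pigeonhole (inj₂ w₁) _ (inj₂ w₃) = t₁≢t₃ (same t₁ t₃ w₁ w₃)
  pigeonhole _ (inj₁ w₂) (inj₁ w₃) = t₂≢t₃ (same t₂ t₃ w₂ w₃)
  pigeonhole _ (inj₂ w₂) (inj₂ w₃) = t₂≢t₃ (same t₂ t₃ w₂ w₃)

lemma15 : (G : Graph) → Klee G → 10 ≤ n G → HasThreeTriangles G →
    (G ≅ tricorn) ⊎ Descendant tricorn G
lemma15 G klee 10≤n three with klee-trichotomy klee
... | inj₁ G≃K₄ = ⊥-elim (from-no (10 ℕ.≤? 4) (subst (10 ≤_) (↔⇒≡ (proj₁ (≃⇒≅ G≃K₄))) 10≤n))
... | inj₂ (inj₁ fromTricorn) = fromTricorn
... | inj₂ (inj₂ P) = ⊥-elim (at-most-two-triangles P three)
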